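{- Let $m\ge0$ be an integer, $s$ a parameter, $q$ an indeterminate, and $$v_n(x,m,s,q)=\sum_{k=0}^{\lfloor n/2\rfloor}(-s)^k q^{k^2}\frac{[n]_q!}{[k]_q!\,[n-2k]_q!}\,\frac{1}{\prod_{j=1}^{k}[m+n-j]_q}\,\frac{1}{(-q;q)_k\,(-q^{n+m-k};q)_k}\,x^{n-2k}.$$ Let $\lambda_0(m,q)=\frac{1+q^m}{[m+1]_q}$ and $\lambda_n(m,q)=\frac{[n+1]_q[n+2m]_q}{[n+m]_q[n+m+1]_q}$ for $n\ge1$. Then $v_0=1$, $v_1=x$, and for $n\ge 2$ $$v_n(x,m,s,q)=x\,v_{n-1}(x,m,s,q)-s\,\lambda_{n-2}(m,q)\frac{q^{n-1}}{(1+q^{n+m-2})(1+q^{n+m-1})}\,v_{n-2}(x,m,s,q).$$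
   Context: $[n]_q=\frac{1-q^n}{1-q}$, $[n]_q!=[1]_q\cdots[n]_q$, $[0]_q!=1$; $(a;q)_n=(1-a)(1-qa)\cdots(1-q^{n-1}a)$, $(a;q)_0=1$; empty products equal $1$. -}

module Defs where

open import Data.Nat as ℕ using (ℕ; zero; suc; _∸_; _/_)
open import Data.List using (List; map; upTo; foldr)
open import Data.Rational using (ℚ; 0ℚ; 1ℚ; _+_; _*_; -_; 1/_; ≢-nonZero)
open import Data.Rational.Properties using (_≟_)
open import Relation.Nullary using (yes; no)

infixr 8 _^_
_^_ : ℚ → ℕ → ℚ
p ^ zero = 1ℚ
p ^ suc n = p * (p ^ n)

-- total inverse: inv p = 1/p for p ≠ 0 (inv 0 = 0, never used under the hypotheses)
inv : ℚ → ℚ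
inv p with p ≟ 0ℚ
... | yes _ = 0ℚ
... | no p≢0 = 1/_ p {{≢-nonZero p≢0}}

sumTo : ℕ → (ℕ → ℚ) → ℚ
sumTo zero f = 0ℚ
sumTo (suc n) f = sumTo n f + f n

prodTo : ℕ → (ℕ → ℚ) → ℚ
prodTo zero f = 1ℚ
prodTo (suc n) f = prodTo n f * f n

-- q-integer [n]_q = 1 + q + ... + q^(n-1)  ( = (1 - q^n)/(1 - q) )
qint : ℚ → ℕ → ℚ
qint q n = sumTo n (λ i → q ^ i)

qfact : ℚ → ℕ → ℚ
qfact q n = prodTo n (λ i → qint q (suc i))

poch : ℚ → ℚ → ℕ → ℚ
poch a q k = prodTo k (λ i → 1ℚ + - ((q ^ i) * a))

v : ℚ → ℕ → ℚ → ℚ → ℕ → ℚ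
v x m s q n = sumTo (suc (n / 2)) term
  where
  term : ℕ → ℚ
  term k =
    ((- s) ^ k) * (q ^ (k ℕ.* k))
    * (qfact q n * inv (qfact q k * qfact q (n ∸ 2 ℕ.* k)))
    * inv (prodTo k (λ i → qint q (m ℕ.+ n ∸ suc i)))          -- ∏_{j=1}^k [m+n-j]_q
    * inv (poch (- q) q k * poch (- (q ^ (n ℕ.+ m ∸ k))) q k)
    * (x ^ (n ∸ 2 ℕ.* k))

lam : ℕ → ℚ → ℕ → ℚ
lam m q zero = (1ℚ + q ^ m) * inv (qint q (suc m))
lam m q (suc n) =
  (qint q (suc n ℕ.+ 1) * qint q (suc n ℕ.+ 2 ℕ.* m))
  * inv (qint q (suc n ℕ.+ m) * qint q (suc n ℕ.+ m ℕ.+ 1))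

-- Write n = 2k + r and e = m + n − k. Since [j]_q (1 + q^j) = [2j]_q, the summand of v_n is
-- (−s)^k q^{k²} [n]_q! / ([r]_q! ∏_{i<k} [2i+2]_q [2e+2i]_q) · x^r. Comparing the coefficients of x^r,
-- the recurrence becomes an identity between the coefficients at (k+1, r, e+1), (k+1, r−1, e) and (k, r, e);
-- their ratios are explicit, and after clearing denominators the identity is the three-term relation
--   [r + 2k + 2]_q [2e]_q = [r]_q [2e + 2k + 2]_q + q^r [2k + 2]_q [n + 2m]_q .
-- It needs [2e]_q ≠ 0, i.e. e > 0; the remaining case n = 2, m = 0 is computed directly.
module Submission where

open import Defs
open import Data.Nat using (ℕ; _≤_; _∸_) renaming (_+_ to _+ℕ_)
open import Data.Rational using (ℚ; 1ℚ; _+_; _*_; -_)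
open import Data.Product using (_×_)
open import Relation.Binary.PropositionalEquality using (_≡_; _≢_)

open import Data.Bool using (if_then_else_)
open import Data.Empty using (⊥; ⊥-elim)
open import Data.Integer using (+≤+)
open import Data.Nat as ℕ using (zero; suc; _<_; _/_; s≤s; z≤n; _≤?_) renaming (_*_ to _*ℕ_)
open import Data.Nat.DivMod using (m*n/n≡m; m/n*n≤m; m/n≤m; /-monoˡ-≤)
import Data.Nat.Properties as ℕ
open import Data.Nat.Tactic.RingSolver renaming (solve-∀ to ℕ-solve-∀)
open import Data.Product using (_,_)
open import Data.Rational using (0ℚ; ∣_∣; *≤*; nonNegative; ≢-nonZero) renaming (_≤_ to _≤ℚ_)
open import Data.Rational.Properties
  using (_≟_; +-*-commutativeRing; 1≢0; *-inverseʳ; *-zeroˡ; *-zeroʳ; *-identityˡ; *-identityʳ; *-assoc; *-comm;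
         +-identityˡ; +-identityʳ; +-inverseʳ; +-assoc; +-mono-≤; ≤-refl; 0≤∣p∣; ∣p∣≡p∨∣p∣≡-p; ∣p*q∣≡∣p∣*∣q∣;
         nonNeg*nonNeg⇒nonNeg; nonNegative⁻¹)
open import Data.Sum using (_⊎_; inj₁; inj₂)
open import Level using (0ℓ)
open import Relation.Binary.PropositionalEquality using (refl; sym; trans; cong; cong₂; subst; subst₂; module ≡-Reasoning)
open import Relation.Nullary using (Dec; yes; no; does; ¬_)
open import Relation.Nullary.Decidable using (dec⇒maybe; dec-true; dec-false)
open import Tactic.RingSolver using (solve-∀)
open import Tactic.RingSolver.Core.AlmostCommutativeRing using (AlmostCommutativeRing; fromCommutativeRing)

ℚ-ring : AlmostCommutativeRing 0ℓ 0ℓ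
ℚ-ring = fromCommutativeRing +-*-commutativeRing (λ p → dec⇒maybe (0ℚ ≟ p))

*-inv : ∀ p → p ≢ 0ℚ → p * inv p ≡ 1ℚ
*-inv p p≢0 with p ≟ 0ℚ
... | yes p≡0 = ⊥-elim (p≢0 p≡0)
... | no p≢0′ = *-inverseʳ p {{≢-nonZero p≢0′}}

*-≢0 : ∀ {p r} → p ≢ 0ℚ → r ≢ 0ℚ → p * r ≢ 0ℚ
*-≢0 {p} {r} p≢0 r≢0 pr≡0 = r≢0 (begin
  r                ≡⟨ sym (*-identityˡ r) ⟩
  1ℚ * r           ≡⟨ cong (_* r) (sym (*-inv p p≢0)) ⟩
  p * inv p * r    ≡⟨ rearrange p (inv p) r ⟩
  inv p * (p * r)  ≡⟨ cong (inv p *_) pr≡0 ⟩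
  inv p * 0ℚ       ≡⟨ *-zeroʳ (inv p) ⟩
  0ℚ               ∎)
  where
  open ≡-Reasoning
  rearrange : ∀ a b c → a * b * c ≡ b * (a * c)
  rearrange = solve-∀ ℚ-ring

inv-unique : ∀ p {r} → p * r ≡ 1ℚ → inv p ≡ r
inv-unique p {r} pr≡1 = begin
  inv p                ≡⟨ sym (*-identityʳ (inv p)) ⟩
  inv p * 1ℚ           ≡⟨ cong (inv p *_) (sym pr≡1) ⟩
  inv p * (p * r)      ≡⟨ rearrange (inv p) p r ⟩
  (p * inv p) * r      ≡⟨ cong (_* r) (*-inv p p≢0) ⟩
  1ℚ * r               ≡⟨ *-identityˡ r ⟩
  r                    ∎
  where
  open ≡-Reasoning
  p≢0 : p ≢ 0ℚ
  p≢0 p≡0 = 1≢0 (trans (sym pr≡1) (trans (cong (_* r) p≡0) (*-zeroˡ r)))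
  rearrange : ∀ a b c → a * (b * c) ≡ (b * a) * c
  rearrange = solve-∀ ℚ-ring

inv-distrib-* : ∀ p r → inv (p * r) ≡ inv p * inv r
inv-distrib-* p r = by-cases (p ≟ 0ℚ) (r ≟ 0ℚ)
  where
  rearrange : ∀ a b c d → a * b * (c * d) ≡ (a * c) * (b * d)
  rearrange = solve-∀ ℚ-ring
  by-cases : Dec (p ≡ 0ℚ) → Dec (r ≡ 0ℚ) → inv (p * r) ≡ inv p * inv r
  by-cases (yes refl) _ = trans (cong inv (*-zeroˡ r)) (sym (*-zeroˡ (inv r)))
  by-cases (no _) (yes refl) = trans (cong inv (*-zeroʳ p)) (sym (*-zeroʳ (inv p)))
  by-cases (no p≢0) (no r≢0) = inv-unique (p * r) (trans (rearrange p r (inv p) (inv r))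
    (cong₂ _*_ (*-inv p p≢0) (*-inv r r≢0)))

inv-*-cancelʳ : ∀ p {r} → r ≢ 0ℚ → inv (p * r) * r ≡ inv p
inv-*-cancelʳ p {r} r≢0 = begin
  inv (p * r) * r          ≡⟨ cong (_* r) (inv-distrib-* p r) ⟩
  inv p * inv r * r        ≡⟨ *-assoc (inv p) (inv r) r ⟩
  inv p * (inv r * r)      ≡⟨ cong (inv p *_) (trans (*-comm (inv r) r) (*-inv r r≢0)) ⟩
  inv p * 1ℚ               ≡⟨ *-identityʳ (inv p) ⟩
  inv p                    ∎
  where open ≡-Reasoning

fraction-step : ∀ U X V V′ {α β} → β ≢ 0ℚ → V′ * β ≡ V * α →
  (U * X) * inv V′ ≡ (U * inv V) * (X * (inv α * β))
fraction-step U X V V′ {α} {β} β≢0 V′β≡Vα = begin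
  (U * X) * inv V′               ≡⟨ cong ((U * X) *_) (sym (inv-*-cancelʳ V′ β≢0)) ⟩
  (U * X) * (inv (V′ * β) * β)   ≡⟨ cong (λ t → (U * X) * (inv t * β)) V′β≡Vα ⟩
  (U * X) * (inv (V * α) * β)    ≡⟨ cong (λ t → (U * X) * (t * β)) (inv-distrib-* V α) ⟩
  (U * X) * (inv V * inv α * β)  ≡⟨ rearrange U X (inv V) (inv α) β ⟩
  (U * inv V) * (X * (inv α * β)) ∎
  where
  open ≡-Reasoning
  rearrange : ∀ a b c d e → (a * b) * (c * d * e) ≡ (a * c) * (b * (d * e))
  rearrange = solve-∀ ℚ-ring

^-distribˡ-+-* : ∀ q a b → q ^ (a +ℕ b) ≡ q ^ a * q ^ b
^-distribˡ-+-* q zero b = sym (*-identityˡ (q ^ b))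
^-distribˡ-+-* q (suc a) b = trans (cong (q *_) (^-distribˡ-+-* q a b)) (sym (*-assoc q (q ^ a) (q ^ b)))

qint-+ : ∀ q a b → qint q (a +ℕ b) ≡ qint q a + q ^ a * qint q b
qint-+ q a zero = trans (cong (qint q) (ℕ.+-identityʳ a)) (sym (x+y*0≡x (qint q a) (q ^ a)))
  where
  x+y*0≡x : ∀ x y → x + y * 0ℚ ≡ x
  x+y*0≡x = solve-∀ ℚ-ring
qint-+ q a (suc b) = begin
  qint q (a +ℕ suc b)                           ≡⟨ cong (qint q) (ℕ.+-suc a b) ⟩
  qint q (a +ℕ b) + q ^ (a +ℕ b)                ≡⟨ cong₂ _+_ (qint-+ q a b) (^-distribˡ-+-* q a b) ⟩
  (qint q a + q ^ a * qint q b) + q ^ a * q ^ b ≡⟨ factor (qint q a) (q ^ a) (qint q b) (q ^ b) ⟩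
  qint q a + q ^ a * (qint q b + q ^ b)         ∎
  where
  open ≡-Reasoning
  factor : ∀ x y z w → (x + y * z) + y * w ≡ x + y * (z + w)
  factor = solve-∀ ℚ-ring

qint-double : ∀ q j → qint q j * (1ℚ + q ^ j) ≡ qint q (j +ℕ j)
qint-double q j = trans (expand (qint q j) (q ^ j)) (sym (qint-+ q j j))
  where
  expand : ∀ x y → x * (1ℚ + y) ≡ x + y * x
  expand = solve-∀ ℚ-ring

qint-exchange : ∀ q x y c →
  qint q (x +ℕ c) * qint q (x +ℕ y) ≡ qint q x * qint q (x +ℕ y +ℕ c) + q ^ x * qint q c * qint q y
qint-exchange q x y c = begin
  qint q (x +ℕ c) * qint q (x +ℕ y)           ≡⟨ cong₂ _*_ (qint-+ q x c) (qint-+ q x y) ⟩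
  (X + qˣ * C) * (X + qˣ * Y)                  ≡⟨ distrib X Y C qˣ ⟩
  X * (X + qˣ * Y) + qˣ * C * (X + qˣ * Y)     ≡⟨ cong (λ t → X * (X + qˣ * Y) + qˣ * C * t) [x+y]≡[y+x] ⟩
  X * (X + qˣ * Y) + qˣ * C * (Y + qʸ * X)     ≡⟨ regroup X Y C qˣ qʸ ⟩
  X * ((X + qˣ * Y) + qˣ * qʸ * C) + qˣ * C * Y ≡⟨ cong (λ t → X * t + qˣ * C * Y) (sym [x+y+c]) ⟩
  X * qint q (x +ℕ y +ℕ c) + qˣ * C * Y        ∎
  where
  open ≡-Reasoning
  X = qint q x
  Y = qint q y
  C = qint q c
  qˣ = q ^ x
  qʸ = q ^ y
  distrib : ∀ X Y C qˣ → (X + qˣ * C) * (X + qˣ * Y) ≡ X * (X + qˣ * Y) + qˣ * C * (X + qˣ * Y)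
  distrib = solve-∀ ℚ-ring
  regroup : ∀ X Y C qˣ qʸ →
    X * (X + qˣ * Y) + qˣ * C * (Y + qʸ * X) ≡ X * ((X + qˣ * Y) + qˣ * qʸ * C) + qˣ * C * Y
  regroup = solve-∀ ℚ-ring
  [x+y]≡[y+x] : X + qˣ * Y ≡ Y + qʸ * X
  [x+y]≡[y+x] = trans (sym (qint-+ q x y)) (trans (cong (qint q) (ℕ.+-comm x y)) (qint-+ q y x))
  [x+y+c] : qint q (x +ℕ y +ℕ c) ≡ (X + qˣ * Y) + qˣ * qʸ * C
  [x+y+c] = trans (qint-+ q (x +ℕ y) c) (cong₂ (λ a b → a + b * C) (qint-+ q x y) (^-distribˡ-+-* q x y))

qint-telescope : ∀ q j → (q + - 1ℚ) * qint q j ≡ q ^ j + - 1ℚ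
qint-telescope q zero = *-zeroʳ (q + - 1ℚ)
qint-telescope q (suc j) = begin
  (q + - 1ℚ) * (qint q j + q ^ j)                ≡⟨ distrib q (qint q j) (q ^ j) ⟩
  (q + - 1ℚ) * qint q j + (q * q ^ j + - q ^ j)  ≡⟨ cong (_+ (q * q ^ j + - q ^ j)) (qint-telescope q j) ⟩
  (q ^ j + - 1ℚ) + (q * q ^ j + - q ^ j)         ≡⟨ cancel (q ^ j) (q * q ^ j) ⟩
  q * q ^ j + - 1ℚ                               ∎
  where
  open ≡-Reasoning
  distrib : ∀ q a b → (q + - 1ℚ) * (a + b) ≡ (q + - 1ℚ) * a + (q * b + - b)
  distrib = solve-∀ ℚ-ring
  cancel : ∀ a b → (a + - 1ℚ) + (b + - a) ≡ b + - 1ℚ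
  cancel = solve-∀ ℚ-ring

∣^∣ : ∀ q j → ∣ q ^ j ∣ ≡ ∣ q ∣ ^ j
∣^∣ q zero = refl
∣^∣ q (suc j) = trans (∣p*q∣≡∣p∣*∣q∣ q (q ^ j)) (cong (∣ q ∣ *_) (∣^∣ q j))

0≤1 : 0ℚ ≤ℚ 1ℚ
0≤1 = *≤* (+≤+ z≤n)

^-nonNeg : ∀ {p} → 0ℚ ≤ℚ p → ∀ j → 0ℚ ≤ℚ p ^ j
^-nonNeg p≥0 zero = 0≤1
^-nonNeg {p} p≥0 (suc j) = nonNegative⁻¹ (p * p ^ j)
  {{nonNeg*nonNeg⇒nonNeg p {{nonNegative p≥0}} (p ^ j) {{nonNegative (^-nonNeg p≥0 j)}}}}

qint-suc-≥1 : ∀ {p} → 0ℚ ≤ℚ p → ∀ j → 1ℚ ≤ℚ qint p (suc j)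
qint-suc-≥1 p≥0 zero = ≤-refl
qint-suc-≥1 p≥0 (suc j) = +-mono-≤ (qint-suc-≥1 p≥0 j) (^-nonNeg p≥0 (suc j))

≥1⇒≢0 : ∀ {p} → 1ℚ ≤ℚ p → p ≢ 0ℚ
≥1⇒≢0 (*≤* (+≤+ ())) refl

x-1≡0⇒x≡1 : ∀ {x} → x + - 1ℚ ≡ 0ℚ → x ≡ 1ℚ
x-1≡0⇒x≡1 {x} x-1≡0 = trans (shift x) (cong (_+ 1ℚ) x-1≡0)
  where
  shift : ∀ x → x ≡ (x + - 1ℚ) + 1ℚ
  shift = solve-∀ ℚ-ring

-- (|q| − 1) [j+1]_|q| = |q|^(j+1) − 1 = 0, while [j+1]_|q| ≥ 1.
∣∣^suc≡1⇒±1 : ∀ q j → ∣ q ∣ ^ suc j ≡ 1ℚ → q ≡ 1ℚ ⊎ q ≡ - 1ℚ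
∣∣^suc≡1⇒±1 q j ∣q∣^suc≡1 = sign (∣p∣≡p∨∣p∣≡-p q)
  where
  p = ∣ q ∣
  [j+1]≢0 : qint p (suc j) ≢ 0ℚ
  [j+1]≢0 = ≥1⇒≢0 (qint-suc-≥1 (0≤∣p∣ q) j)
  p-1≡0 : p + - 1ℚ ≡ 0ℚ
  p-1≡0 with (p + - 1ℚ) ≟ 0ℚ
  ... | yes p-1≡0 = p-1≡0
  ... | no p-1≢0 = ⊥-elim (*-≢0 p-1≢0 [j+1]≢0
        (trans (qint-telescope p (suc j)) (trans (cong (_+ - 1ℚ) ∣q∣^suc≡1) (+-inverseʳ 1ℚ))))
  neg-involutive : ∀ x → - (- x) ≡ x
  neg-involutive = solve-∀ ℚ-ring
  sign : p ≡ q ⊎ p ≡ - q → q ≡ 1ℚ ⊎ q ≡ - 1ℚ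
  sign (inj₁ p≡q) = inj₁ (trans (sym p≡q) (x-1≡0⇒x≡1 p-1≡0))
  sign (inj₂ p≡-q) = inj₂ (trans (sym (neg-involutive q)) (cong -_ (trans (sym p≡-q) (x-1≡0⇒x≡1 p-1≡0))))

qint-suc-≢0 : ∀ {q} → q ≢ - 1ℚ → ∀ j → qint q (suc j) ≢ 0ℚ
qint-suc-≢0 {q} q≢-1 j [j+1]≡0 = excluded (∣∣^suc≡1⇒±1 q j (trans (sym (∣^∣ q (suc j))) (cong ∣_∣ q^suc≡1)))
  where
  q^suc≡1 : q ^ suc j ≡ 1ℚ
  q^suc≡1 = x-1≡0⇒x≡1 (trans (sym (qint-telescope q (suc j)))
    (trans (cong ((q + - 1ℚ) *_) [j+1]≡0) (*-zeroʳ (q + - 1ℚ))))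
  excluded : q ≡ 1ℚ ⊎ q ≡ - 1ℚ → ⊥
  excluded (inj₁ q≡1) = ≥1⇒≢0 (qint-suc-≥1 0≤1 j) (subst (λ t → qint t (suc j) ≡ 0ℚ) q≡1 [j+1]≡0)
  excluded (inj₂ q≡-1) = q≢-1 q≡-1

qint-≢0 : ∀ {q} → q ≢ - 1ℚ → ∀ {j} → 0 < j → qint q j ≢ 0ℚ
qint-≢0 q≢-1 {suc j} _ = qint-suc-≢0 q≢-1 j

qfact-≢0 : ∀ {q} → q ≢ - 1ℚ → ∀ n → qfact q n ≢ 0ℚ
qfact-≢0 q≢-1 zero = 1≢0
qfact-≢0 q≢-1 (suc n) = *-≢0 (qfact-≢0 q≢-1 n) (qint-suc-≢0 q≢-1 n)

sumTo-cong : ∀ k {f g : ℕ → ℚ} → (∀ {i} → i < k → f i ≡ g i) → sumTo k f ≡ sumTo k g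
sumTo-cong zero f≗g = refl
sumTo-cong (suc k) f≗g = cong₂ _+_ (sumTo-cong k (λ i<k → f≗g (ℕ.m<n⇒m<1+n i<k))) (f≗g ℕ.≤-refl)

sumTo-head : ∀ k (f : ℕ → ℚ) → sumTo (suc k) f ≡ f 0 + sumTo k (λ i → f (suc i))
sumTo-head zero f = trans (+-identityˡ (f 0)) (sym (+-identityʳ (f 0)))
sumTo-head (suc k) f = trans (cong (_+ f (suc k)) (sumTo-head k f)) (+-assoc (f 0) _ _)

sumTo-linear : ∀ k a b (f g : ℕ → ℚ) → sumTo k (λ i → a * f i + b * g i) ≡ a * sumTo k f + b * sumTo k g
sumTo-linear zero a b f g = sym (a*0+b*0≡0 a b)
  where
  a*0+b*0≡0 : ∀ a b → a * 0ℚ + b * 0ℚ ≡ 0ℚ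
  a*0+b*0≡0 = solve-∀ ℚ-ring
sumTo-linear (suc k) a b f g =
  trans (cong (_+ (a * f k + b * g k)) (sumTo-linear k a b f g)) (regroup a b (sumTo k f) (sumTo k g) (f k) (g k))
  where
  regroup : ∀ a b x y z w → (a * x + b * y) + (a * z + b * w) ≡ a * (x + z) + b * (y + w)
  regroup = solve-∀ ℚ-ring

sumTo-pad : ∀ {k H} {f : ℕ → ℚ} → k ℕ.≤′ H → (∀ {i} → k ≤ i → f i ≡ 0ℚ) → sumTo H f ≡ sumTo k f
sumTo-pad ℕ.≤′-refl f≡0 = refl
sumTo-pad {H = suc H} (ℕ.≤′-step k≤′H) f≡0 =
  trans (cong₂ _+_ (sumTo-pad k≤′H f≡0) (f≡0 (ℕ.≤′⇒≤ k≤′H))) (+-identityʳ _)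

prodTo-cong : ∀ k {f g : ℕ → ℚ} → (∀ i → f i ≡ g i) → prodTo k f ≡ prodTo k g
prodTo-cong zero f≗g = refl
prodTo-cong (suc k) f≗g = cong₂ _*_ (prodTo-cong k f≗g) (f≗g k)

prodTo-head : ∀ k (f : ℕ → ℚ) → prodTo (suc k) f ≡ f 0 * prodTo k (λ i → f (suc i))
prodTo-head zero f = trans (*-identityˡ (f 0)) (sym (*-identityʳ (f 0)))
prodTo-head (suc k) f = trans (cong (_* f (suc k)) (prodTo-head k f)) (*-assoc (f 0) _ _)

prodTo-*-distrib : ∀ k (f g : ℕ → ℚ) → prodTo k f * prodTo k g ≡ prodTo k (λ i → f i * g i)
prodTo-*-distrib zero f g = refl
prodTo-*-distrib (suc k) f g =
  trans (interchange (prodTo k f) (f k) (prodTo k g) (g k)) (cong (_* (f k * g k)) (prodTo-*-distrib k f g))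
  where
  interchange : ∀ a b c d → (a * b) * (c * d) ≡ (a * c) * (b * d)
  interchange = solve-∀ ℚ-ring

rising : (ℕ → ℚ) → ℕ → ℕ → ℚ
rising f e k = prodTo k (λ i → f (e +ℕ i))

rising-head : ∀ f e k → f e * rising f (suc e) k ≡ rising f e (suc k)
rising-head f e k = sym (trans (prodTo-head k (λ i → f (e +ℕ i)))
  (cong₂ _*_ (cong f (ℕ.+-identityʳ e)) (prodTo-cong k (λ i → cong f (ℕ.+-suc e i)))))

rising-reverse : ∀ f e k → prodTo k (λ i → f (e +ℕ k ∸ suc i)) ≡ rising f e k
rising-reverse f e zero = refl
rising-reverse f e (suc k) = begin
  prodTo (suc k) (λ i → f (e +ℕ suc k ∸ suc i))     ≡⟨ cong (λ t → prodTo (suc k) (λ i → f (t ∸ suc i))) (ℕ.+-suc e k) ⟩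
  prodTo (suc k) (λ i → f (suc (e +ℕ k) ∸ suc i))   ≡⟨ prodTo-head k _ ⟩
  f (e +ℕ k) * prodTo k (λ i → f (e +ℕ k ∸ suc i))  ≡⟨ cong (f (e +ℕ k) *_) (rising-reverse f e k) ⟩
  f (e +ℕ k) * rising f e k                          ≡⟨ *-comm (f (e +ℕ k)) (rising f e k) ⟩
  rising f e (suc k)                                 ∎
  where open ≡-Reasoning

double≤⇒≤half : ∀ {k n} → 2 *ℕ k ≤ n → k ≤ n / 2
double≤⇒≤half {k} {n} 2k≤n =
  subst (_≤ n / 2) (trans (cong (_/ 2) (ℕ.*-comm 2 k)) (m*n/n≡m k 2)) (/-monoˡ-≤ 2 2k≤n)

≤half⇒double≤ : ∀ {k n} → k ≤ n / 2 → 2 *ℕ k ≤ n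
≤half⇒double≤ {k} {n} k≤n/2 = ℕ.≤-trans (ℕ.*-monoʳ-≤ 2 k≤n/2) (subst (_≤ n) (ℕ.*-comm (n / 2) 2) (m/n*n≤m n 2))

double-suc : ∀ k → 2 *ℕ suc k ≡ suc (suc (2 *ℕ k))
double-suc k = cong suc (ℕ.+-suc k (k +ℕ 0))

double-suc-≤ : ∀ k r → 2 *ℕ suc k ≤ suc (suc (2 *ℕ k +ℕ r))
double-suc-≤ k r = subst (_≤ suc (suc (2 *ℕ k +ℕ r))) (sym (double-suc k)) (s≤s (s≤s (ℕ.m≤m+n (2 *ℕ k) r)))

module Coefficients (s q : ℚ) (q≢-1 : q ≢ - 1ℚ) where

  [_] : ℕ → ℚ
  [ n ] = qint q n

  [_]! : ℕ → ℚ
  [ n ]! = qfact q n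

  evenRising : ℕ → ℕ → ℚ
  evenRising = rising (λ j → [ j +ℕ j ])

  numer : ℕ → ℕ → ℚ
  numer k r = (- s) ^ k * q ^ (k *ℕ k) * [ 2 *ℕ k +ℕ r ]!

  denom : ℕ → ℕ → ℕ → ℚ
  denom k r e = [ r ]! * (evenRising 1 k * evenRising e k)

  coeff : ℕ → ℕ → ℕ → ℚ
  coeff k r e = numer k r * inv (denom k r e)

  growth : ℕ → ℕ → ℚ
  growth K j = (- s) * q ^ suc (2 *ℕ K) * [ j ]

  denomStep : ℕ → ℕ → ℚ
  denomStep K e = [ suc K +ℕ suc K ] * [ (e +ℕ K) +ℕ (e +ℕ K) ]

  tradeFactor : ℕ → ℕ → ℕ → ℚ
  tradeFactor K r e = growth K (suc (2 *ℕ K +ℕ r)) * (inv (denomStep K e) * [ r ])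

  shiftFactor : ℕ → ℕ → ℕ → ℚ
  shiftFactor K r e = (growth K (suc N) * [ suc (suc N) ])
                      * (inv (denomStep K e * [ suc (e +ℕ K) +ℕ suc (e +ℕ K) ]) * [ e +ℕ e ])
    where N = 2 *ℕ K +ℕ r

  numer-suc : ∀ K r j → 2 *ℕ suc K +ℕ r ≡ suc j →
    numer (suc K) r ≡ ((- s) ^ K * q ^ (K *ℕ K) * [ j ]!) * growth K (suc j)
  numer-suc K r j eq = begin
    (- s) * (- s) ^ K * q ^ (suc K *ℕ suc K) * [ 2 *ℕ suc K +ℕ r ]!
      ≡⟨ cong₂ (λ a b → (- s) * (- s) ^ K * q ^ a * [ b ]!) (square-suc K) eq ⟩
    (- s) * (- s) ^ K * q ^ (K *ℕ K +ℕ suc (2 *ℕ K)) * ([ j ]! * [ suc j ])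
      ≡⟨ cong (λ t → (- s) * (- s) ^ K * t * ([ j ]! * [ suc j ])) (^-distribˡ-+-* q (K *ℕ K) (suc (2 *ℕ K))) ⟩
    (- s) * (- s) ^ K * (q ^ (K *ℕ K) * q ^ suc (2 *ℕ K)) * ([ j ]! * [ suc j ])
      ≡⟨ regroup (- s) ((- s) ^ K) (q ^ (K *ℕ K)) (q ^ suc (2 *ℕ K)) [ j ]! [ suc j ] ⟩
    ((- s) ^ K * q ^ (K *ℕ K) * [ j ]!) * growth K (suc j) ∎
    where
    open ≡-Reasoning
    square-suc : ∀ K → suc K *ℕ suc K ≡ K *ℕ K +ℕ suc (2 *ℕ K)
    square-suc = ℕ-solve-∀
    regroup : ∀ a b c d e f → a * b * (c * d) * (e * f) ≡ (b * c * e) * (a * d * f)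
    regroup = solve-∀ ℚ-ring

  denom-trade : ∀ K r e → denom (suc K) r e * [ suc r ] ≡ denom K (suc r) e * denomStep K e
  denom-trade K r e = regroup [ r ]! (evenRising 1 K) [ suc K +ℕ suc K ] (evenRising e K)
                              [ (e +ℕ K) +ℕ (e +ℕ K) ] [ suc r ]
    where
    regroup : ∀ a b c d f g → a * (b * c * (d * f)) * g ≡ a * g * (b * d) * (c * f)
    regroup = solve-∀ ℚ-ring

  denom-shift : ∀ K r e → denom (suc K) r (suc e) * [ e +ℕ e ] ≡
                denom K r e * (denomStep K e * [ suc (e +ℕ K) +ℕ suc (e +ℕ K) ])
  denom-shift K r e = begin
    [ r ]! * (E₁ * d₁ * (E′ * d₃)) * dₑ   ≡⟨ regroup₁ [ r ]! E₁ d₁ E′ d₃ dₑ ⟩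
    [ r ]! * E₁ * d₁ * d₃ * (dₑ * E′)     ≡⟨ cong ([ r ]! * E₁ * d₁ * d₃ *_) (rising-head (λ j → [ j +ℕ j ]) e K) ⟩
    [ r ]! * E₁ * d₁ * d₃ * (Eₑ * d₂)     ≡⟨ regroup₂ [ r ]! E₁ d₁ d₃ Eₑ d₂ ⟩
    denom K r e * (denomStep K e * d₃)    ∎
    where
    open ≡-Reasoning
    E₁ = evenRising 1 K
    Eₑ = evenRising e K
    E′ = evenRising (suc e) K
    d₁ = [ suc K +ℕ suc K ]
    d₂ = [ (e +ℕ K) +ℕ (e +ℕ K) ]
    d₃ = [ suc (e +ℕ K) +ℕ suc (e +ℕ K) ]
    dₑ = [ e +ℕ e ]
    regroup₁ : ∀ a b c d f g → a * (b * c * (d * f)) * g ≡ a * b * c * f * (g * d)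
    regroup₁ = solve-∀ ℚ-ring
    regroup₂ : ∀ a b c f d g → a * b * c * f * (d * g) ≡ a * (b * d) * (c * g * f)
    regroup₂ = solve-∀ ℚ-ring

  coeff-trade : ∀ K r e → coeff (suc K) r e ≡ coeff K (suc r) e * tradeFactor K (suc r) e
  coeff-trade K r e = begin
    numer (suc K) r * inv (denom (suc K) r e)
      ≡⟨ cong (_* inv (denom (suc K) r e)) (numer-suc K r (2 *ℕ K +ℕ suc r) (index K r)) ⟩
    numer K (suc r) * growth K (suc (2 *ℕ K +ℕ suc r)) * inv (denom (suc K) r e)
      ≡⟨ fraction-step (numer K (suc r)) (growth K (suc (2 *ℕ K +ℕ suc r))) (denom K (suc r) e) (denom (suc K) r e)
                       (qint-suc-≢0 q≢-1 r) (denom-trade K r e) ⟩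
    coeff K (suc r) e * tradeFactor K (suc r) e ∎
    where
    open ≡-Reasoning
    index : ∀ K r → 2 *ℕ suc K +ℕ r ≡ suc (2 *ℕ K +ℕ suc r)
    index = ℕ-solve-∀

  coeff-shift : ∀ K r e → 0 < e → coeff (suc K) r (suc e) ≡ coeff K r e * shiftFactor K r e
  coeff-shift K r e 0<e = begin
    numer (suc K) r * inv (denom (suc K) r (suc e))
      ≡⟨ cong (_* inv (denom (suc K) r (suc e))) (numer-suc K r (suc N) (index K r)) ⟩
    ((- s) ^ K * q ^ (K *ℕ K) * ([ N ]! * [ suc N ])) * growth K (suc (suc N)) * inv (denom (suc K) r (suc e))
      ≡⟨ cong (_* inv (denom (suc K) r (suc e)))
              (regroup ((- s) ^ K * q ^ (K *ℕ K)) [ N ]! [ suc N ] (- s) (q ^ suc (2 *ℕ K)) [ suc (suc N) ]) ⟩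
    numer K r * (growth K (suc N) * [ suc (suc N) ]) * inv (denom (suc K) r (suc e))
      ≡⟨ fraction-step (numer K r) (growth K (suc N) * [ suc (suc N) ]) (denom K r e) (denom (suc K) r (suc e))
                       (qint-≢0 q≢-1 (ℕ.+-mono-≤ 0<e z≤n)) (denom-shift K r e) ⟩
    coeff K r e * shiftFactor K r e ∎
    where
    open ≡-Reasoning
    N = 2 *ℕ K +ℕ r
    index : ∀ K r → 2 *ℕ suc K +ℕ r ≡ suc (suc (2 *ℕ K +ℕ r))
    index = ℕ-solve-∀
    regroup : ∀ a F x w Q y → a * (F * x) * (w * Q * y) ≡ a * F * (w * Q * x * y)
    regroup = solve-∀ ℚ-ring

  coeff-zero : ∀ r e → coeff 0 r e ≡ 1ℚ
  coeff-zero r e = trans (cong₂ (λ a b → a * inv b) (1*1*x≡x [ r ]!) (x*[1*1]≡x [ r ]!)) (*-inv [ r ]! (qfact-≢0 q≢-1 r))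
    where
    1*1*x≡x : ∀ x → 1ℚ * 1ℚ * x ≡ x
    1*1*x≡x = solve-∀ ℚ-ring
    x*[1*1]≡x : ∀ x → x * (1ℚ * 1ℚ) ≡ x
    x*[1*1]≡x = solve-∀ ℚ-ring

  -- The summand k = 1 of v_2 for m = 0, the one case with e = 0.
  coeff-base : coeff 1 0 1 ≡ - (s * q) * inv [ 2 ]
  coeff-base = begin
    coeff 1 0 1                                    ≡⟨ cong₂ (λ a b → a * inv b) (numer-1-0 s q [ 2 ]) (denom-1-0-1 [ 2 ]) ⟩
    (- (s * q) * [ 2 ]) * inv ([ 2 ] * [ 2 ])      ≡⟨ cong ((- (s * q) * [ 2 ]) *_) (inv-distrib-* [ 2 ] [ 2 ]) ⟩
    (- (s * q) * [ 2 ]) * (inv [ 2 ] * inv [ 2 ])  ≡⟨ regroup (- (s * q)) [ 2 ] (inv [ 2 ]) ⟩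
    - (s * q) * ([ 2 ] * inv [ 2 ]) * inv [ 2 ]    ≡⟨ cong (λ t → - (s * q) * t * inv [ 2 ]) (*-inv [ 2 ] (qint-suc-≢0 q≢-1 1)) ⟩
    - (s * q) * 1ℚ * inv [ 2 ]                     ≡⟨ cong (_* inv [ 2 ]) (*-identityʳ (- (s * q))) ⟩
    - (s * q) * inv [ 2 ]                          ∎
    where
    open ≡-Reasoning
    numer-1-0 : ∀ s q P → (- s) * 1ℚ * (q * 1ℚ) * (1ℚ * 1ℚ * P) ≡ - (s * q) * P
    numer-1-0 = solve-∀ ℚ-ring
    denom-1-0-1 : ∀ P → 1ℚ * (1ℚ * P * (1ℚ * P)) ≡ P * P
    denom-1-0-1 = solve-∀ ℚ-ring
    regroup : ∀ a P i → (a * P) * (i * i) ≡ a * (P * i) * i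
    regroup = solve-∀ ℚ-ring

module Recurrence (m : ℕ) (s q : ℚ) (q≢-1 : q ≢ - 1ℚ) where
  open Coefficients s q q≢-1

  recCoeff : ℕ → ℚ
  recCoeff N = - (s * lam m q N * q ^ suc N * inv ((1ℚ + q ^ (N +ℕ m)) * (1ℚ + q ^ suc (N +ℕ m))))

  -- For N = 0 this needs [m]_q ≠ 0, which is where m = 0 has to be excluded.
  lam-closed : ∀ N → 0 < N +ℕ m → lam m q N ≡ ([ suc N ] * [ N +ℕ 2 *ℕ m ]) * inv ([ N +ℕ m ] * [ suc (N +ℕ m) ])
  lam-closed (suc N) _ = cong₂ (λ a b → ([ a ] * [ suc N +ℕ 2 *ℕ m ]) * inv ([ suc N +ℕ m ] * [ b ]))
                               (ℕ.+-comm (suc N) 1) (ℕ.+-comm (suc N +ℕ m) 1)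
  lam-closed zero 0<m = begin
    (1ℚ + q ^ m) * inv [ suc m ]
      ≡⟨ sym (trans (cong ((1ℚ + q ^ m) * inv [ suc m ] *_) (*-inv [ m ] (qint-≢0 q≢-1 0<m))) (*-identityʳ _)) ⟩
    (1ℚ + q ^ m) * inv [ suc m ] * ([ m ] * inv [ m ])
      ≡⟨ regroup (1ℚ + q ^ m) (inv [ suc m ]) [ m ] (inv [ m ]) ⟩
    (1ℚ * ([ m ] * (1ℚ + q ^ m))) * (inv [ m ] * inv [ suc m ])
      ≡⟨ cong₂ (λ a b → (1ℚ * a) * b) (trans (qint-double q m) (cong [_] (cong (m +ℕ_) (sym (ℕ.+-identityʳ m)))))
                                      (sym (inv-distrib-* [ m ] [ suc m ])) ⟩
    ([ 1 ] * [ 2 *ℕ m ]) * inv ([ m ] * [ suc m ])           ∎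
    where
    open ≡-Reasoning
    regroup : ∀ a b c d → a * b * (c * d) ≡ (1ℚ * (c * a)) * (d * b)
    regroup = solve-∀ ℚ-ring

  -- e = m + n − K for the summand with k = K and n = 2K + r
  risingStart : ℕ → ℕ → ℕ
  risingStart K r = r +ℕ K +ℕ m

  recCoeff-closed : ∀ K r → 0 < risingStart K r → let e = risingStart K r in
    recCoeff (2 *ℕ K +ℕ r) ≡ growth K (suc (2 *ℕ K +ℕ r)) * q ^ r * [ 2 *ℕ K +ℕ r +ℕ 2 *ℕ m ]
                             * inv ([ (e +ℕ K) +ℕ (e +ℕ K) ] * [ suc (e +ℕ K) +ℕ suc (e +ℕ K) ])
  recCoeff-closed K r 0<e = begin
    - (s * lam m q N * q ^ suc N * inv ((1ℚ + q ^ (N +ℕ m)) * (1ℚ + q ^ suc (N +ℕ m))))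
      ≡⟨ cong (λ l → - (s * l * q ^ suc N * inv ((1ℚ + q ^ (N +ℕ m)) * (1ℚ + q ^ suc (N +ℕ m)))))
              (lam-closed N (subst (0 <_) (sym N+m≡e+K) (ℕ.≤-trans 0<e (ℕ.m≤m+n e K)))) ⟩
    - (s * (([ suc N ] * [ Y ]) * inv ([ N +ℕ m ] * [ suc (N +ℕ m) ])) * q ^ suc N
         * inv ((1ℚ + q ^ (N +ℕ m)) * (1ℚ + q ^ suc (N +ℕ m))))
      ≡⟨ cong₂ (λ t Q → - (s * (([ suc N ] * [ Y ]) * inv ([ t ] * [ suc t ])) * Q * inv ((1ℚ + q ^ t) * (1ℚ + q ^ suc t))))
               N+m≡e+K (^-distribˡ-+-* q (suc (2 *ℕ K)) r) ⟩
    - (s * (([ suc N ] * [ Y ]) * inv ([ t ] * [ suc t ])) * (q ^ suc (2 *ℕ K) * q ^ r)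
         * inv ((1ℚ + q ^ t) * (1ℚ + q ^ suc t)))
      ≡⟨ regroup s [ suc N ] [ Y ] (inv ([ t ] * [ suc t ])) (q ^ suc (2 *ℕ K)) (q ^ r) (inv ((1ℚ + q ^ t) * (1ℚ + q ^ suc t))) ⟩
    growth K (suc N) * q ^ r * [ Y ] * (inv ([ t ] * [ suc t ]) * inv ((1ℚ + q ^ t) * (1ℚ + q ^ suc t)))
      ≡⟨ cong (growth K (suc N) * q ^ r * [ Y ] *_) inv-doubles ⟩
    growth K (suc N) * q ^ r * [ Y ] * inv ([ t +ℕ t ] * [ suc t +ℕ suc t ]) ∎
    where
    open ≡-Reasoning
    N = 2 *ℕ K +ℕ r
    Y = N +ℕ 2 *ℕ m
    e = risingStart K r
    t = e +ℕ K
    N+m≡e+K : N +ℕ m ≡ t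
    N+m≡e+K = index K r m
      where
      index : ∀ K r m → 2 *ℕ K +ℕ r +ℕ m ≡ r +ℕ K +ℕ m +ℕ K
      index = ℕ-solve-∀
    regroup : ∀ s a y iP Q qʳ iD → - (s * ((a * y) * iP) * (Q * qʳ) * iD) ≡ (- s) * Q * a * qʳ * y * (iP * iD)
    regroup = solve-∀ ℚ-ring
    inv-doubles : inv ([ t ] * [ suc t ]) * inv ((1ℚ + q ^ t) * (1ℚ + q ^ suc t)) ≡ inv ([ t +ℕ t ] * [ suc t +ℕ suc t ])
    inv-doubles = begin
      inv ([ t ] * [ suc t ]) * inv ((1ℚ + q ^ t) * (1ℚ + q ^ suc t))
        ≡⟨ sym (inv-distrib-* ([ t ] * [ suc t ]) _) ⟩
      inv (([ t ] * [ suc t ]) * ((1ℚ + q ^ t) * (1ℚ + q ^ suc t)))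
        ≡⟨ cong inv (interchange [ t ] [ suc t ] (1ℚ + q ^ t) (1ℚ + q ^ suc t)) ⟩
      inv (([ t ] * (1ℚ + q ^ t)) * ([ suc t ] * (1ℚ + q ^ suc t)))
        ≡⟨ cong inv (cong₂ _*_ (qint-double q t) (qint-double q (suc t))) ⟩
      inv ([ t +ℕ t ] * [ suc t +ℕ suc t ]) ∎
      where
      interchange : ∀ a b c d → (a * b) * (c * d) ≡ (a * c) * (b * d)
      interchange = solve-∀ ℚ-ring

  shiftFactor-split : ∀ K r → 0 < risingStart K r → let e = risingStart K r in
    shiftFactor K r e ≡ tradeFactor K r e + recCoeff (2 *ℕ K +ℕ r)
  shiftFactor-split K r 0<e = begin
    (G * [ suc (suc N) ]) * (inv (D₁₂ * D₃) * [ e +ℕ e ])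
      ≡⟨ regroup G [ suc (suc N) ] (inv (D₁₂ * D₃)) [ e +ℕ e ] ⟩
    G * (inv (D₁₂ * D₃) * ([ suc (suc N) ] * [ e +ℕ e ]))
      ≡⟨ cong (λ z → G * (inv (D₁₂ * D₃) * z)) exchange ⟩
    G * (inv (D₁₂ * D₃) * ([ r ] * D₃ + q ^ r * [ Y ] * D₁))
      ≡⟨ distrib G (inv (D₁₂ * D₃)) [ r ] D₃ (q ^ r) [ Y ] D₁ ⟩
    G * ((inv (D₁₂ * D₃) * D₃) * [ r ]) + G * q ^ r * [ Y ] * (inv (D₁₂ * D₃) * D₁)
      ≡⟨ cong₂ (λ a b → G * (a * [ r ]) + G * q ^ r * [ Y ] * b) (inv-*-cancelʳ D₁₂ D₃≢0) cancel-D₁ ⟩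
    G * (inv D₁₂ * [ r ]) + G * q ^ r * [ Y ] * inv (D₂ * D₃)
      ≡⟨ cong (G * (inv D₁₂ * [ r ]) +_) (sym (recCoeff-closed K r 0<e)) ⟩
    tradeFactor K r e + recCoeff N ∎
    where
    open ≡-Reasoning
    N = 2 *ℕ K +ℕ r
    Y = N +ℕ 2 *ℕ m
    e = risingStart K r
    G = growth K (suc N)
    D₁ = [ suc K +ℕ suc K ]
    D₂ = [ (e +ℕ K) +ℕ (e +ℕ K) ]
    D₃ = [ suc (e +ℕ K) +ℕ suc (e +ℕ K) ]
    D₁₂ = denomStep K e
    D₃≢0 : D₃ ≢ 0ℚ
    D₃≢0 = qint-suc-≢0 q≢-1 (e +ℕ K +ℕ suc (e +ℕ K))
    cancel-D₁ : inv (D₁₂ * D₃) * D₁ ≡ inv (D₂ * D₃)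
    cancel-D₁ = trans (cong (λ z → inv z * D₁) (rotate D₁ D₂ D₃)) (inv-*-cancelʳ (D₂ * D₃) (qint-suc-≢0 q≢-1 (K +ℕ suc K)))
      where
      rotate : ∀ a b c → a * b * c ≡ b * c * a
      rotate = solve-∀ ℚ-ring
    exchange : [ suc (suc N) ] * [ e +ℕ e ] ≡ [ r ] * D₃ + q ^ r * [ Y ] * D₁
    exchange = begin
      [ suc (suc N) ] * [ e +ℕ e ]
        ≡⟨ cong₂ (λ a b → [ a ] * [ b ]) (sym (index₁ K r)) (sym (index₂ K r m)) ⟩
      [ r +ℕ (suc K +ℕ suc K) ] * [ r +ℕ Y ]
        ≡⟨ qint-exchange q r Y (suc K +ℕ suc K) ⟩
      [ r ] * [ r +ℕ Y +ℕ (suc K +ℕ suc K) ] + q ^ r * D₁ * [ Y ]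
        ≡⟨ cong₂ (λ a b → [ r ] * [ a ] + b) (index₃ K r m) (*-assoc (q ^ r) D₁ [ Y ]) ⟩
      [ r ] * D₃ + q ^ r * (D₁ * [ Y ])
        ≡⟨ cong (λ z → [ r ] * D₃ + q ^ r * z) (*-comm D₁ [ Y ]) ⟩
      [ r ] * D₃ + q ^ r * ([ Y ] * D₁)
        ≡⟨ cong ([ r ] * D₃ +_) (sym (*-assoc (q ^ r) [ Y ] D₁)) ⟩
      [ r ] * D₃ + q ^ r * [ Y ] * D₁ ∎
      where
      index₁ : ∀ K r → r +ℕ (suc K +ℕ suc K) ≡ suc (suc (2 *ℕ K +ℕ r))
      index₁ = ℕ-solve-∀
      index₂ : ∀ K r m → r +ℕ (2 *ℕ K +ℕ r +ℕ 2 *ℕ m) ≡ r +ℕ K +ℕ m +ℕ (r +ℕ K +ℕ m)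
      index₂ = ℕ-solve-∀
      index₃ : ∀ K r m → r +ℕ (2 *ℕ K +ℕ r +ℕ 2 *ℕ m) +ℕ (suc K +ℕ suc K)
                         ≡ suc (r +ℕ K +ℕ m +ℕ K) +ℕ suc (r +ℕ K +ℕ m +ℕ K)
      index₃ = ℕ-solve-∀
    regroup : ∀ G b iD c → (G * b) * (iD * c) ≡ G * (iD * (b * c))
    regroup = solve-∀ ℚ-ring
    distrib : ∀ G iD ρ D₃ qʳ y D₁ → G * (iD * (ρ * D₃ + qʳ * y * D₁)) ≡ G * ((iD * D₃) * ρ) + G * qʳ * y * (iD * D₁)
    distrib = solve-∀ ℚ-ring

  coeff-recurrence : ∀ K r → 0 < risingStart K r → let e = risingStart K r in
    coeff (suc K) r (suc e) ≡ coeff K r e * tradeFactor K r e + recCoeff (2 *ℕ K +ℕ r) * coeff K r e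
  coeff-recurrence K r 0<e = begin
    coeff (suc K) r (suc e)                                  ≡⟨ coeff-shift K r e 0<e ⟩
    coeff K r e * shiftFactor K r e                          ≡⟨ cong (coeff K r e *_) (shiftFactor-split K r 0<e) ⟩
    coeff K r e * (tradeFactor K r e + recCoeff N)           ≡⟨ distrib (coeff K r e) (tradeFactor K r e) (recCoeff N) ⟩
    coeff K r e * tradeFactor K r e + recCoeff N * coeff K r e ∎
    where
    open ≡-Reasoning
    N = 2 *ℕ K +ℕ r
    e = risingStart K r
    distrib : ∀ c t ρ → c * (t + ρ) ≡ c * t + ρ * c
    distrib = solve-∀ ℚ-ring

  coeff-recurrence-zero⁺ : ∀ K → 0 < risingStart K 0 → let e = risingStart K 0 in
    coeff (suc K) 0 (suc e) ≡ recCoeff (2 *ℕ K +ℕ 0) * coeff K 0 e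
  coeff-recurrence-zero⁺ K 0<e = begin
    coeff (suc K) 0 (suc e)                                    ≡⟨ coeff-recurrence K 0 0<e ⟩
    coeff K 0 e * tradeFactor K 0 e + recCoeff N * coeff K 0 e ≡⟨ cong (_+ recCoeff N * coeff K 0 e) no-trade ⟩
    0ℚ + recCoeff N * coeff K 0 e                              ≡⟨ +-identityˡ (recCoeff N * coeff K 0 e) ⟩
    recCoeff N * coeff K 0 e                                   ∎
    where
    open ≡-Reasoning
    N = 2 *ℕ K +ℕ 0
    e = risingStart K 0
    vanish : ∀ c g i → c * (g * (i * 0ℚ)) ≡ 0ℚ
    vanish = solve-∀ ℚ-ring
    no-trade : coeff K 0 e * tradeFactor K 0 e ≡ 0ℚ
    no-trade = vanish (coeff K 0 e) (growth K (suc N)) (inv (denomStep K e))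

  recCoeff-base : - (s * lam 0 q 0 * q ^ 1 * inv ((1ℚ + q ^ 0) * (1ℚ + q ^ 1))) ≡ - (s * q) * inv [ 2 ]
  recCoeff-base = begin
    - (s * ((1ℚ + 1ℚ) * 1ℚ) * (q * 1ℚ) * inv ((1ℚ + 1ℚ) * [ 2 ]))
      ≡⟨ cong (λ t → - (s * ((1ℚ + 1ℚ) * 1ℚ) * (q * 1ℚ) * t)) (inv-distrib-* (1ℚ + 1ℚ) [ 2 ]) ⟩
    - (s * ((1ℚ + 1ℚ) * 1ℚ) * (q * 1ℚ) * (inv (1ℚ + 1ℚ) * inv [ 2 ]))
      ≡⟨ regroup s q (1ℚ + 1ℚ) (inv (1ℚ + 1ℚ)) (inv [ 2 ]) ⟩
    - (s * q) * ((1ℚ + 1ℚ) * inv (1ℚ + 1ℚ)) * inv [ 2 ]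
      ≡⟨ cong (λ t → - (s * q) * t * inv [ 2 ]) (*-inv (1ℚ + 1ℚ) (λ ())) ⟩
    - (s * q) * 1ℚ * inv [ 2 ]
      ≡⟨ cong (_* inv [ 2 ]) (*-identityʳ (- (s * q))) ⟩
    - (s * q) * inv [ 2 ] ∎
    where
    open ≡-Reasoning
    regroup : ∀ s q t i j → - (s * (t * 1ℚ) * (q * 1ℚ) * (i * j)) ≡ - (s * q) * (t * i) * j
    regroup = solve-∀ ℚ-ring

  coeff-recurrence-zero : ∀ K → let e = risingStart K 0 in
    coeff (suc K) 0 (suc e) ≡ recCoeff (2 *ℕ K +ℕ 0) * coeff K 0 e
  coeff-recurrence-zero (suc K) = coeff-recurrence-zero⁺ (suc K) (s≤s z≤n)
  coeff-recurrence-zero zero with ℕ.m≤n⇒m<n∨m≡n (z≤n {m})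
  ... | inj₁ 0<m = coeff-recurrence-zero⁺ zero 0<m
  ... | inj₂ 0≡m = begin
    coeff 1 0 (suc m)          ≡⟨ cong (λ t → coeff 1 0 (suc t)) (sym 0≡m) ⟩
    coeff 1 0 1                ≡⟨ coeff-base ⟩
    - (s * q) * inv [ 2 ]      ≡⟨ sym (trans (*-identityʳ (recCoeff-at 0)) recCoeff-base) ⟩
    recCoeff-at 0 * 1ℚ         ≡⟨ cong₂ (λ t c → recCoeff-at t * c) 0≡m (sym (coeff-zero 0 m)) ⟩
    recCoeff 0 * coeff 0 0 m   ∎
    where
    open ≡-Reasoning
    recCoeff-at : ℕ → ℚ
    recCoeff-at m = - (s * lam m q 0 * q ^ 1 * inv ((1ℚ + q ^ m) * (1ℚ + q ^ suc m)))

  coeff-recurrence-suc : ∀ K r → let e = risingStart K (suc r) in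
    coeff (suc K) (suc r) (suc e) ≡ coeff (suc K) r e + recCoeff (2 *ℕ K +ℕ suc r) * coeff K (suc r) e
  coeff-recurrence-suc K r = trans (coeff-recurrence K (suc r) (s≤s z≤n))
    (cong (_+ recCoeff (2 *ℕ K +ℕ suc r) * coeff K (suc r) (risingStart K (suc r)))
          (sym (coeff-trade K r (risingStart K (suc r)))))

  module Terms (x : ℚ) where

    term : ℕ → ℕ → ℚ
    term n k =
      ((- s) ^ k) * (q ^ (k *ℕ k))
      * (qfact q n * inv (qfact q k * qfact q (n ∸ 2 *ℕ k)))
      * inv (prodTo k (λ i → qint q (m +ℕ n ∸ suc i)))
      * inv (poch (- q) q k * poch (- (q ^ (n +ℕ m ∸ k))) q k)
      * (x ^ (n ∸ 2 *ℕ k))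

    term-normal : ∀ k r e {n} → 2 *ℕ k +ℕ r ≡ n → e +ℕ k ≡ m +ℕ n → term n k ≡ coeff k r e * x ^ r
    term-normal k r e refl e+k≡m+n = begin
      a * (F * inv ([ k ]! * [ n ∸ 2 *ℕ k ]!)) * inv (prodTo k (λ i → [ m +ℕ n ∸ suc i ]))
        * inv (poch (- q) q k * poch (- (q ^ (n +ℕ m ∸ k))) q k) * x ^ (n ∸ 2 *ℕ k)
        ≡⟨ cong₂ (λ j P → a * (F * inv ([ k ]! * [ j ]!)) * inv P * inv (poch (- q) q k * poch (- (q ^ (n +ℕ m ∸ k))) q k) * x ^ j)
                 n∸2k≡r [m+n-j]≡rising ⟩
      a * (F * inv ([ k ]! * [ r ]!)) * inv (rising [_] e k)
        * inv (poch (- q) q k * poch (- (q ^ (n +ℕ m ∸ k))) q k) * x ^ r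
        ≡⟨ cong₂ (λ P₁ P₂ → a * (F * inv ([ k ]! * [ r ]!)) * inv (rising [_] e k) * inv (P₁ * P₂) * x ^ r)
                 poch[-q]≡rising poch[-qᵉ]≡rising ⟩
      a * (F * inv ([ k ]! * [ r ]!)) * inv (rising [_] e k) * inv (rising 1+q^ 1 k * rising 1+q^ e k) * x ^ r
        ≡⟨ cong (_* x ^ r) collect-inv ⟩
      a * F * inv ([ k ]! * [ r ]! * rising [_] e k * (rising 1+q^ 1 k * rising 1+q^ e k)) * x ^ r
        ≡⟨ cong (λ D → a * F * inv D * x ^ r) collect-denom ⟩
      coeff k r e * x ^ r ∎
      where
      open ≡-Reasoning
      n = 2 *ℕ k +ℕ r
      a = (- s) ^ k * q ^ (k *ℕ k)
      F = [ n ]!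
      1+q^ : ℕ → ℚ
      1+q^ j = 1ℚ + q ^ j
      n∸2k≡r : n ∸ 2 *ℕ k ≡ r
      n∸2k≡r = ℕ.m+n∸m≡n (2 *ℕ k) r
      [m+n-j]≡rising : prodTo k (λ i → [ m +ℕ n ∸ suc i ]) ≡ rising [_] e k
      [m+n-j]≡rising = trans (cong (λ t → prodTo k (λ i → [ t ∸ suc i ])) (sym e+k≡m+n)) (rising-reverse [_] e k)
      poch[-q]≡rising : poch (- q) q k ≡ rising 1+q^ 1 k
      poch[-q]≡rising = prodTo-cong k (λ i → sign (q ^ i) q)
        where
        sign : ∀ a b → 1ℚ + - (a * - b) ≡ 1ℚ + b * a
        sign = solve-∀ ℚ-ring
      poch[-qᵉ]≡rising : poch (- (q ^ (n +ℕ m ∸ k))) q k ≡ rising 1+q^ e k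
      poch[-qᵉ]≡rising = prodTo-cong k (λ i → trans (cong (λ t → 1ℚ + - (q ^ i * - (q ^ t))) n+m∸k≡e)
                                               (trans (sign (q ^ i) (q ^ e)) (cong (1ℚ +_) (sym (^-distribˡ-+-* q e i)))))
        where
        n+m∸k≡e : n +ℕ m ∸ k ≡ e
        n+m∸k≡e = trans (cong (_∸ k) (trans (ℕ.+-comm n m) (sym e+k≡m+n))) (ℕ.m+n∸n≡m e k)
        sign : ∀ a b → 1ℚ + - (a * - b) ≡ 1ℚ + b * a
        sign = solve-∀ ℚ-ring
      collect-inv : a * (F * inv ([ k ]! * [ r ]!)) * inv (rising [_] e k) * inv (rising 1+q^ 1 k * rising 1+q^ e k)
                    ≡ a * F * inv ([ k ]! * [ r ]! * rising [_] e k * (rising 1+q^ 1 k * rising 1+q^ e k))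
      collect-inv = trans (regroup a F (inv A) (inv B) (inv C))
        (cong (a * F *_) (sym (trans (inv-distrib-* (A * B) C) (cong (_* inv C) (inv-distrib-* A B)))))
        where
        A = [ k ]! * [ r ]!
        B = rising [_] e k
        C = rising 1+q^ 1 k * rising 1+q^ e k
        regroup : ∀ a F iA iB iC → a * (F * iA) * iB * iC ≡ a * F * (iA * iB * iC)
        regroup = solve-∀ ℚ-ring
      collect-denom : [ k ]! * [ r ]! * rising [_] e k * (rising 1+q^ 1 k * rising 1+q^ e k) ≡ denom k r e
      collect-denom = trans (regroup [ k ]! [ r ]! (rising [_] e k) (rising 1+q^ 1 k) (rising 1+q^ e k))
                            (cong₂ (λ P₁ P₂ → [ r ]! * (P₁ * P₂)) (rising-doubles 1) (rising-doubles e))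
        where
        regroup : ∀ a b c d f → a * b * c * (d * f) ≡ b * ((a * d) * (c * f))
        regroup = solve-∀ ℚ-ring
        rising-doubles : ∀ e → rising [_] e k * rising 1+q^ e k ≡ evenRising e k
        rising-doubles e = trans (prodTo-*-distrib k _ _) (prodTo-cong k (λ i → qint-double q (e +ℕ i)))

    -- For 2k > n the truncated n ∸ 2k makes term n k a junk value, not 0.
    term₀ : ℕ → ℕ → ℚ
    term₀ n k = if does (2 *ℕ k ≤? n) then term n k else 0ℚ

    term₀-fit : ∀ n k → 2 *ℕ k ≤ n → term₀ n k ≡ term n k
    term₀-fit n k fit rewrite dec-true (2 *ℕ k ≤? n) fit = refl

    term₀-unfit : ∀ n k → ¬ 2 *ℕ k ≤ n → term₀ n k ≡ 0ℚ
    term₀-unfit n k unfit rewrite dec-false (2 *ℕ k ≤? n) unfit = refl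

    v≡sum-term₀ : ∀ n H → n < H → v x m s q n ≡ sumTo H (term₀ n)
    v≡sum-term₀ n H n<H = begin
      v x m s q n                    ≡⟨⟩
      sumTo (suc (n / 2)) (term n)
        ≡⟨ sumTo-cong (suc (n / 2)) (λ {k} k<1+n/2 → sym (term₀-fit n k (≤half⇒double≤ (ℕ.≤-pred k<1+n/2)))) ⟩
      sumTo (suc (n / 2)) (term₀ n)  ≡⟨ sym (sumTo-pad (ℕ.≤⇒≤′ (ℕ.≤-trans (s≤s (m/n≤m n 2)) n<H))
                                             (λ {k} n/2<k → term₀-unfit n k (λ fit → ℕ.<⇒≱ n/2<k (double≤⇒≤half fit)))) ⟩
      sumTo H (term₀ n)              ∎
      where open ≡-Reasoning

    term-zero : ∀ n → term n 0 ≡ x ^ n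
    term-zero n = trans (term-normal 0 n (m +ℕ n) refl (ℕ.+-identityʳ (m +ℕ n)))
                        (trans (cong (_* x ^ n) (coeff-zero n (m +ℕ n))) (*-identityˡ (x ^ n)))

    term₀-zero : ∀ N → term₀ (suc (suc N)) 0 ≡ x * term₀ (suc N) 0
    term₀-zero N = trans (term₀-fit (suc (suc N)) 0 z≤n) (trans (term-zero (suc (suc N)))
                         (cong (x *_) (sym (trans (term₀-fit (suc N) 0 z≤n) (term-zero (suc N))))))

    term₀-recurrence-edge : ∀ K → let N = 2 *ℕ K +ℕ 0 in
      term₀ (suc (suc N)) (suc K) ≡ x * term₀ (suc N) (suc K) + recCoeff N * term₀ N K
    term₀-recurrence-edge K = begin
      term₀ (suc (suc N)) (suc K)         ≡⟨ term₀-fit (suc (suc N)) (suc K) (double-suc-≤ K 0) ⟩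
      term (suc (suc N)) (suc K)          ≡⟨ term-normal (suc K) 0 (suc e) (index₂ K) (index₂′ K m) ⟩
      coeff (suc K) 0 (suc e) * x ^ 0     ≡⟨ cong (_* x ^ 0) (coeff-recurrence-zero K) ⟩
      recCoeff N * coeff K 0 e * x ^ 0    ≡⟨ regroup x (recCoeff N) (coeff K 0 e) (x ^ 0) ⟩
      x * 0ℚ + recCoeff N * (coeff K 0 e * x ^ 0)
        ≡⟨ cong₂ (λ a b → x * a + recCoeff N * b) (sym (term₀-unfit (suc N) (suc K) unfit))
                 (sym (trans (term₀-fit N K (ℕ.m≤m+n _ 0)) (term-normal K 0 e refl (index₀ K m)))) ⟩
      x * term₀ (suc N) (suc K) + recCoeff N * term₀ N K ∎
      where
      open ≡-Reasoning
      N = 2 *ℕ K +ℕ 0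
      e = risingStart K 0
      unfit : ¬ 2 *ℕ suc K ≤ suc N
      unfit 2K+2≤N+1 = ℕ.<-irrefl (sym (ℕ.+-identityʳ (2 *ℕ K))) (ℕ.≤-pred (subst (_≤ suc N) (double-suc K) 2K+2≤N+1))
      index₂ : ∀ K → 2 *ℕ suc K +ℕ 0 ≡ suc (suc (2 *ℕ K +ℕ 0))
      index₂ = ℕ-solve-∀
      index₂′ : ∀ K m → suc (0 +ℕ K +ℕ m) +ℕ suc K ≡ m +ℕ suc (suc (2 *ℕ K +ℕ 0))
      index₂′ = ℕ-solve-∀
      index₀ : ∀ K m → 0 +ℕ K +ℕ m +ℕ K ≡ m +ℕ (2 *ℕ K +ℕ 0)
      index₀ = ℕ-solve-∀
      regroup : ∀ x c κ y → c * κ * y ≡ x * 0ℚ + c * (κ * y)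
      regroup = solve-∀ ℚ-ring

    term₀-recurrence-inner : ∀ K r → let N = 2 *ℕ K +ℕ suc r in
      term₀ (suc (suc N)) (suc K) ≡ x * term₀ (suc N) (suc K) + recCoeff N * term₀ N K
    term₀-recurrence-inner K r = begin
      term₀ (suc (suc N)) (suc K)         ≡⟨ term₀-fit (suc (suc N)) (suc K) (double-suc-≤ K (suc r)) ⟩
      term (suc (suc N)) (suc K)          ≡⟨ term-normal (suc K) (suc r) (suc e) (index₂ K r) (index₂′ K r m) ⟩
      coeff (suc K) (suc r) (suc e) * x ^ suc r
        ≡⟨ cong (_* x ^ suc r) (coeff-recurrence-suc K r) ⟩
      (coeff (suc K) r e + recCoeff N * coeff K (suc r) e) * x ^ suc r
        ≡⟨ regroup x (coeff (suc K) r e) (recCoeff N) (coeff K (suc r) e) (x ^ r) ⟩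
      x * (coeff (suc K) r e * x ^ r) + recCoeff N * (coeff K (suc r) e * x ^ suc r)
        ≡⟨ cong₂ (λ a b → x * a + recCoeff N * b)
                 (sym (trans (term₀-fit (suc N) (suc K) fit₁) (term-normal (suc K) r e (index₁ K r) (index₁′ K r m))))
                 (sym (trans (term₀-fit N K (ℕ.m≤m+n _ (suc r))) (term-normal K (suc r) e refl (index₀ K r m)))) ⟩
      x * term₀ (suc N) (suc K) + recCoeff N * term₀ N K ∎
      where
      open ≡-Reasoning
      N = 2 *ℕ K +ℕ suc r
      e = risingStart K (suc r)
      fit₁ : 2 *ℕ suc K ≤ suc N
      fit₁ = subst₂ _≤_ (sym (double-suc K)) (cong suc (sym (ℕ.+-suc (2 *ℕ K) r))) (s≤s (s≤s (ℕ.m≤m+n _ r)))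
      index₂ : ∀ K r → 2 *ℕ suc K +ℕ suc r ≡ suc (suc (2 *ℕ K +ℕ suc r))
      index₂ = ℕ-solve-∀
      index₂′ : ∀ K r m → suc (suc r +ℕ K +ℕ m) +ℕ suc K ≡ m +ℕ suc (suc (2 *ℕ K +ℕ suc r))
      index₂′ = ℕ-solve-∀
      index₁ : ∀ K r → 2 *ℕ suc K +ℕ r ≡ suc (2 *ℕ K +ℕ suc r)
      index₁ = ℕ-solve-∀
      index₁′ : ∀ K r m → suc r +ℕ K +ℕ m +ℕ suc K ≡ m +ℕ suc (2 *ℕ K +ℕ suc r)
      index₁′ = ℕ-solve-∀
      index₀ : ∀ K r m → suc r +ℕ K +ℕ m +ℕ K ≡ m +ℕ (2 *ℕ K +ℕ suc r)
      index₀ = ℕ-solve-∀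
      regroup : ∀ x a c b y → (a + c * b) * (x * y) ≡ x * (a * y) + c * (b * (x * y))
      regroup = solve-∀ ℚ-ring

    term₀-recurrence : ∀ N K → term₀ (suc (suc N)) (suc K) ≡ x * term₀ (suc N) (suc K) + recCoeff N * term₀ N K
    term₀-recurrence N K with 2 *ℕ K ≤? N
    ... | yes 2K≤N with ℕ.m≤n⇒∃[o]m+o≡n 2K≤N
    ...   | zero , refl = term₀-recurrence-edge K
    ...   | suc r , refl = term₀-recurrence-inner K r
    term₀-recurrence N K | no 2K≰N = begin
      term₀ (suc (suc N)) (suc K)
        ≡⟨ term₀-unfit (suc (suc N)) (suc K) (λ fit → 2K≰N (ℕ.≤-pred (ℕ.≤-pred (≤-double-suc fit)))) ⟩
      0ℚ                                                ≡⟨ sym (x*0+c*0≡0 x (recCoeff N)) ⟩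
      x * 0ℚ + recCoeff N * 0ℚ
        ≡⟨ sym (cong₂ (λ a b → x * a + recCoeff N * b)
                      (term₀-unfit (suc N) (suc K) (λ fit → 2K≰N (ℕ.<⇒≤ (ℕ.≤-pred (≤-double-suc fit)))))
                      (term₀-unfit N K 2K≰N)) ⟩
      x * term₀ (suc N) (suc K) + recCoeff N * term₀ N K ∎
      where
      open ≡-Reasoning
      ≤-double-suc : ∀ {j} → 2 *ℕ suc K ≤ j → suc (suc (2 *ℕ K)) ≤ j
      ≤-double-suc {j} = subst (_≤ j) (double-suc K)
      x*0+c*0≡0 : ∀ x c → x * 0ℚ + c * 0ℚ ≡ 0ℚ
      x*0+c*0≡0 = solve-∀ ℚ-ring

    recurrence : ∀ N → v x m s q (suc (suc N)) ≡ x * v x m s q (suc N) + recCoeff N * v x m s q N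
    recurrence N = begin
      v x m s q (suc (suc N))
        ≡⟨ v≡sum-term₀ (suc (suc N)) (suc (suc (suc N))) ℕ.≤-refl ⟩
      sumTo (suc (suc (suc N))) (term₀ (suc (suc N)))
        ≡⟨ sumTo-head (suc (suc N)) (term₀ (suc (suc N))) ⟩
      term₀ (suc (suc N)) 0 + sumTo (suc (suc N)) (λ K → term₀ (suc (suc N)) (suc K))
        ≡⟨ cong₂ _+_ (term₀-zero N) (sumTo-cong (suc (suc N)) (λ {K} _ → term₀-recurrence N K)) ⟩
      x * term₀ (suc N) 0 + sumTo (suc (suc N)) (λ K → x * term₀ (suc N) (suc K) + recCoeff N * term₀ N K)
        ≡⟨ cong (x * term₀ (suc N) 0 +_) (sumTo-linear (suc (suc N)) x (recCoeff N) _ _) ⟩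
      x * term₀ (suc N) 0 + (x * sumTo (suc (suc N)) (λ K → term₀ (suc N) (suc K)) + recCoeff N * sumTo (suc (suc N)) (term₀ N))
        ≡⟨ regroup x (recCoeff N) _ _ _ ⟩
      x * (term₀ (suc N) 0 + sumTo (suc (suc N)) (λ K → term₀ (suc N) (suc K))) + recCoeff N * sumTo (suc (suc N)) (term₀ N)
        ≡⟨ cong₂ (λ a b → x * a + recCoeff N * b)
                 (sym (trans (v≡sum-term₀ (suc N) (suc (suc (suc N))) (ℕ.m≤n⇒m≤1+n ℕ.≤-refl))
                             (sumTo-head (suc (suc N)) (term₀ (suc N)))))
                 (sym (v≡sum-term₀ N (suc (suc N)) (ℕ.m≤n⇒m≤1+n ℕ.≤-refl))) ⟩
      x * v x m s q (suc N) + recCoeff N * v x m s q N ∎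
      where
      open ≡-Reasoning
      regroup : ∀ x c a b d → x * a + (x * b + c * d) ≡ x * (a + b) + c * d
      regroup = solve-∀ ℚ-ring

mainTheorem10 : (m : ℕ) (s q x : ℚ) → q ≢ - 1ℚ →
  (v x m s q 0 ≡ 1ℚ) × (v x m s q 1 ≡ x) ×
  ((n : ℕ) → 2 ≤ n →
    v x m s q n ≡ x * v x m s q (n ∸ 1)
      + - (s * lam m q (n ∸ 2) * (q ^ (n ∸ 1))
           * inv ((1ℚ + q ^ (n +ℕ m ∸ 2)) * (1ℚ + q ^ (n +ℕ m ∸ 1))))
          * v x m s q (n ∸ 2))
mainTheorem10 m s q x q≢-1 = v₀ , v₁ , λ { (suc (suc N)) (s≤s (s≤s _)) → recurrence N }
  where
  open Recurrence m s q q≢-1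
  open Terms x
  v₀ : v x m s q 0 ≡ 1ℚ
  v₀ = trans (cong (0ℚ +_) (term-zero 0)) (+-identityˡ 1ℚ)
  v₁ : v x m s q 1 ≡ x
  v₁ = trans (cong (0ℚ +_) (term-zero 1)) (trans (+-identityˡ (x * 1ℚ)) (*-identityʳ x))
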